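{- Let $G$ be a nontrivial connected graph of order $n$ and maximum degree $\Delta$. Then $\gamma_{tR2}(G)\ge \left\lceil \frac{2n}{\Delta+1}\right\rceil$. Moreover, if $\gamma_{tR2}(G)=\frac{2n}{\Delta+1}$, then $V_2=\emptyset$ for every $\gamma_{tR2}(G)$-function $f=(V_0,V_1,V_2)$.
   Context: All graphs are finite and simple. For $f:V(G)\to\{0,1,2\}$ let $V_i=\{v:f(v)=i\}$ and write $f=(V_0,V_1,V_2)$; $f$ is a total Roman $\{2\}$-dominating function (TR2DF) if every vertex $v$ with $f(v)=0$ has a neighbor $u$ with $f(u)=2$ or two distinct neighbors $x,y$ with $f(x)=f(y)=1$, and the subgraph induced by $V_1\cup V_2$ has no isolated vertices. $\gamma_{tR2}(G)$ is the minimum weight $\sum_v f(v)$ of a TR2DF, and a TR2DF of that weight is a $\gamma_{tR2}(G)$-function. -}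

module Defs where

open import Data.Nat using (ℕ; zero; suc; _+_; _*_; _≤_; _<_)
open import Data.Nat.DivMod using (_/_)
open import Data.Fin using (Fin)
open import Data.Bool using (Bool; true; false)
open import Data.List using (List; []; _∷_; length; filter; map; allFin)
open import Data.Nat.ListAction using (sum)
open import Data.Product using (Σ; ∃; _×_; _,_)
open import Data.Sum using (_⊎_)
open import Relation.Binary.PropositionalEquality using (_≡_; _≢_)
open import Relation.Nullary using (¬_)
open import Data.Bool.Properties using (T?)
open import Data.Bool using (T)

record Graph (n : ℕ) : Set where
  field
    adj    : Fin n → Fin n → Bool
    sym    : ∀ u v → adj u v ≡ adj v u
    irrefl : ∀ v → adj v v ≡ false

open Graph public

Adj : ∀ {n} → Graph n → Fin n → Fin n → Set
Adj G u v = adj G u v ≡ true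

degree : ∀ {n} → Graph n → Fin n → ℕ
degree {n} G v = length (filter (λ u → T? (adj G v u)) (allFin n))

IsMaxDegree : ∀ {n} → Graph n → ℕ → Set
IsMaxDegree G Δ = (∀ v → degree G v ≤ Δ) × ∃ λ v → degree G v ≡ Δ

data Walk {n : ℕ} (G : Graph n) : Fin n → Fin n → Set where
  here : ∀ {v} → Walk G v v
  step : ∀ {u w v} → Adj G u w → Walk G w v → Walk G u v

Connected : ∀ {n} → Graph n → Set
Connected G = ∀ u v → Walk G u v

Nontrivial : ∀ {n} → Graph n → Set
Nontrivial {n} G = 2 ≤ n

-- a function f : V(G) → {0,1,2}, values encoded as naturals below 3
Labeling : ℕ → Set
Labeling n = Fin n → ℕ

IsLabeling : ∀ {n} → Labeling n → Set
IsLabeling f = ∀ v → f v < 3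

weight : ∀ {n} → Labeling n → ℕ
weight {n} f = sum (map f (allFin n))

IsTR2DF : ∀ {n} → Graph n → Labeling n → Set
IsTR2DF G f =
  IsLabeling f ×
  (∀ v → f v ≡ 0 →
     (∃ λ u → Adj G v u × f u ≡ 2) ⊎
     (∃ λ x → ∃ λ y → x ≢ y × Adj G v x × Adj G v y × f x ≡ 1 × f y ≡ 1)) ×
  (∀ v → f v ≢ 0 → ∃ λ u → Adj G v u × f u ≢ 0)

IsGammaTR2Function : ∀ {n} → Graph n → Labeling n → Set
IsGammaTR2Function G f = IsTR2DF G f × (∀ g → IsTR2DF G g → weight f ≤ weight g)

GammaTR2 : ∀ {n} → Graph n → ℕ → Set
GammaTR2 G k = ∃ λ f → IsGammaTR2Function G f × weight f ≡ k

-- ⌈ a / (b+1) ⌉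
ceilDivSuc : ℕ → ℕ → ℕ
ceilDivSuc a b = (a + b) / suc b

{-# OPTIONS --safe #-}
-- Let N[v] be the total weight f puts on the closed neighbourhood of v. The
-- conditions on a TR2DF force N[v] ≥ 2 for every vertex, and N[v] ≥ 3 when
-- f v = 2. Double counting, each vertex u contributes f u to N[u] and to N[w]
-- for its at most Δ neighbours w, so Σ N[v] ≤ (Δ + 1)·w(f). Hence
-- 2n ≤ (Δ + 1)·w(f), strictly if some vertex has label 2.
module Submission where

open import Defs hiding (sym)
open import Data.Nat using (ℕ; zero; suc; _+_; _*_; _≤_; _<_; z≤n; _≟_)
open import Data.Nat.Properties
open import Data.Nat.DivMod using (m<n*o⇒m/o<n)
open import Data.Fin using (Fin; zero; suc)
open import Data.Bool using (Bool; true; false; if_then_else_)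
open import Data.Bool.Properties using (T?)
open import Data.List using (length; filter; tabulate)
open import Data.List.Properties using (map-tabulate)
import Data.Nat.ListAction as List
open import Algebra.Properties.Semiring.Sum +-*-semiring
  using (sum; sum-syntax; sum-cong-≗; ∑-comm; ∑-distrib-+; *-distribˡ-sum; *-distribʳ-sum)
open import Function using (_∘_)
open import Data.Product using (_×_; _,_)
open import Data.Sum using (inj₁; inj₂)
open import Relation.Nullary using (yes; no; contradiction)
open import Relation.Binary.PropositionalEquality

∑-mono-≤ : ∀ {n} {g h : Fin n → ℕ} → (∀ i → g i ≤ h i) → sum g ≤ sum h
∑-mono-≤ {zero}  g≤h = z≤n
∑-mono-≤ {suc n} g≤h = +-mono-≤ (g≤h zero) (∑-mono-≤ (λ i → g≤h (suc i)))

∑-mono-< : ∀ {n} {g h : Fin n → ℕ} → (∀ i → g i ≤ h i) → ∀ i → g i < h i → sum g < sum h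
∑-mono-< g≤h zero    g<h = +-mono-<-≤ g<h (∑-mono-≤ (λ i → g≤h (suc i)))
∑-mono-< g≤h (suc i) g<h = +-mono-≤-< (g≤h zero) (∑-mono-< (λ j → g≤h (suc j)) i g<h)

∑-const : ∀ n c → sum {n} (λ _ → c) ≡ c * n
∑-const zero    c = sym (*-zeroʳ c)
∑-const (suc n) c = trans (cong (c +_) (∑-const n c)) (sym (*-suc c n))

term≤∑ : ∀ {n} (g : Fin n → ℕ) i → g i ≤ sum g
term≤∑ g zero    = m≤m+n _ _
term≤∑ g (suc i) = ≤-trans (term≤∑ (λ j → g (suc j)) i) (m≤n+m _ _)

twoTerms≤∑ : ∀ {n} (g : Fin n → ℕ) i j → i ≢ j → g i + g j ≤ sum g
twoTerms≤∑ g zero    zero    i≢j = contradiction refl i≢j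
twoTerms≤∑ g zero    (suc j) i≢j = +-monoʳ-≤ (g zero) (term≤∑ _ j)
twoTerms≤∑ g (suc i) zero    i≢j =
  subst (_≤ sum g) (+-comm (g zero) (g (suc i))) (+-monoʳ-≤ (g zero) (term≤∑ _ i))
twoTerms≤∑ g (suc i) (suc j) i≢j =
  ≤-trans (twoTerms≤∑ (λ k → g (suc k)) i j (i≢j ∘ cong suc)) (m≤n+m _ _)

listSum-tabulate : ∀ {n} (g : Fin n → ℕ) → List.sum (tabulate g) ≡ sum g
listSum-tabulate {zero}  g = refl
listSum-tabulate {suc n} g = cong (g zero +_) (listSum-tabulate (λ i → g (suc i)))

weight≡∑ : ∀ {n} (f : Labeling n) → weight f ≡ sum f
weight≡∑ f = trans (cong List.sum (map-tabulate (λ i → i) f)) (listSum-tabulate f)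

length-filter-tabulate : ∀ {A : Set} {n} (p : A → Bool) (h : Fin n → A) →
  length (filter (λ a → T? (p a)) (tabulate h)) ≡ ∑[ i < n ] (if p (h i) then 1 else 0)
length-filter-tabulate {n = zero}  p h = refl
length-filter-tabulate {n = suc n} p h with p (h zero)
... | true  = cong suc (length-filter-tabulate p (λ i → h (suc i)))
... | false = length-filter-tabulate p (λ i → h (suc i))

if-then-1-else-0-* : ∀ b x → (if b then 1 else 0) * x ≡ (if b then x else 0)
if-then-1-else-0-* true  x = +-identityʳ x
if-then-1-else-0-* false x = refl

module _ {n} (G : Graph n) (f : Labeling n) where

  neighbourhoodWeight : Fin n → ℕ
  neighbourhoodWeight v = ∑[ u < n ] (if adj G v u then f u else 0)

  closedNeighbourhoodWeight : Fin n → ℕ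
  closedNeighbourhoodWeight v = f v + neighbourhoodWeight v

  degree≡∑ : ∀ v → degree G v ≡ ∑[ u < n ] (if adj G v u then 1 else 0)
  degree≡∑ v = length-filter-tabulate (adj G v) (λ u → u)

  neighbour≤neighbourhoodWeight : ∀ {v u} → Adj G v u → f u ≤ neighbourhoodWeight v
  neighbour≤neighbourhoodWeight {v} {u} v~u =
    subst (_≤ neighbourhoodWeight v) (cong (λ b → if b then f u else 0) v~u)
          (term≤∑ (λ w → if adj G v w then f w else 0) u)

  twoNeighbours≤neighbourhoodWeight : ∀ {v x y} → x ≢ y → Adj G v x → Adj G v y →
    f x + f y ≤ neighbourhoodWeight v
  twoNeighbours≤neighbourhoodWeight {v} {x} {y} x≢y v~x v~y =
    subst (_≤ neighbourhoodWeight v)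
          (cong₂ _+_ (cong (λ b → if b then f x else 0) v~x) (cong (λ b → if b then f y else 0) v~y))
          (twoTerms≤∑ (λ w → if adj G v w then f w else 0) x y x≢y)

  ∑-column≡degree* : ∀ u → ∑[ v < n ] (if adj G v u then f u else 0) ≡ degree G u * f u
  ∑-column≡degree* u = begin
    ∑[ v < n ] (if adj G v u then f u else 0)
      ≡⟨ sum-cong-≗ (λ v → cong (λ b → if b then f u else 0) (Graph.sym G v u)) ⟩
    ∑[ v < n ] (if adj G u v then f u else 0)
      ≡⟨ sum-cong-≗ (λ v → if-then-1-else-0-* (adj G u v) (f u)) ⟨
    ∑[ v < n ] ((if adj G u v then 1 else 0) * f u)
      ≡⟨ *-distribʳ-sum (f u) (λ v → if adj G u v then 1 else 0) ⟨
    (∑[ v < n ] (if adj G u v then 1 else 0)) * f u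
      ≡⟨ cong (_* f u) (degree≡∑ u) ⟨
    degree G u * f u ∎
    where open ≡-Reasoning

  ∑-neighbourhoodWeight≤ : ∀ {Δ} → (∀ v → degree G v ≤ Δ) →
    ∑[ v < n ] neighbourhoodWeight v ≤ Δ * sum f
  ∑-neighbourhoodWeight≤ {Δ} deg≤Δ = begin
    ∑[ v < n ] ∑[ u < n ] (if adj G v u then f u else 0)
      ≡⟨ ∑-comm (λ v u → if adj G v u then f u else 0) ⟩
    ∑[ u < n ] ∑[ v < n ] (if adj G v u then f u else 0)
      ≡⟨ sum-cong-≗ ∑-column≡degree* ⟩
    ∑[ u < n ] (degree G u * f u)
      ≤⟨ ∑-mono-≤ (λ u → *-monoˡ-≤ (f u) (deg≤Δ u)) ⟩
    ∑[ u < n ] (Δ * f u)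
      ≡⟨ *-distribˡ-sum Δ f ⟨
    Δ * sum f ∎
    where open ≤-Reasoning

  nonisolated⇒1≤neighbourhoodWeight : IsTR2DF G f → ∀ v → f v ≢ 0 → 1 ≤ neighbourhoodWeight v
  nonisolated⇒1≤neighbourhoodWeight (_ , _ , noIsolated) v fv≢0 with noIsolated v fv≢0
  ... | u , v~u , fu≢0 = ≤-trans (n≢0⇒n>0 fu≢0) (neighbour≤neighbourhoodWeight v~u)

  2≤closedNeighbourhoodWeight : IsTR2DF G f → ∀ v → 2 ≤ closedNeighbourhoodWeight v
  2≤closedNeighbourhoodWeight tr@(_ , dominated , _) v with f v ≟ 0
  ... | no fv≢0 = +-mono-≤ (n≢0⇒n>0 fv≢0) (nonisolated⇒1≤neighbourhoodWeight tr v fv≢0)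
  ... | yes fv≡0 with dominated v fv≡0
  ...   | inj₁ (u , v~u , fu≡2) =
    ≤-trans (subst (_≤ neighbourhoodWeight v) fu≡2 (neighbour≤neighbourhoodWeight v~u))
            (m≤n+m _ _)
  ...   | inj₂ (x , y , x≢y , v~x , v~y , fx≡1 , fy≡1) =
    ≤-trans (subst (_≤ neighbourhoodWeight v) (cong₂ _+_ fx≡1 fy≡1)
                   (twoNeighbours≤neighbourhoodWeight x≢y v~x v~y))
            (m≤n+m _ _)

  3≤closedNeighbourhoodWeight : IsTR2DF G f → ∀ v → f v ≡ 2 → 3 ≤ closedNeighbourhoodWeight v
  3≤closedNeighbourhoodWeight tr v fv≡2 =
    +-mono-≤ (≤-reflexive (sym fv≡2))
             (nonisolated⇒1≤neighbourhoodWeight tr v (λ fv≡0 → 0≢1+n (trans (sym fv≡0) fv≡2)))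

  ∑-closedNeighbourhoodWeight≤ : ∀ {Δ} → (∀ v → degree G v ≤ Δ) →
    ∑[ v < n ] closedNeighbourhoodWeight v ≤ weight f * suc Δ
  ∑-closedNeighbourhoodWeight≤ {Δ} deg≤Δ = begin
    ∑[ v < n ] closedNeighbourhoodWeight v ≡⟨ ∑-distrib-+ f neighbourhoodWeight ⟩
    sum f + ∑[ v < n ] neighbourhoodWeight v ≤⟨ +-monoʳ-≤ (sum f) (∑-neighbourhoodWeight≤ deg≤Δ) ⟩
    sum f + Δ * sum f                        ≡⟨ *-comm (suc Δ) (sum f) ⟩
    sum f * suc Δ                            ≡⟨ cong (_* suc Δ) (weight≡∑ f) ⟨
    weight f * suc Δ                         ∎
    where open ≤-Reasoning

  TR2DF-weight-bound : ∀ {Δ} → (∀ v → degree G v ≤ Δ) → IsTR2DF G f →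
    2 * n ≤ weight f * suc Δ
  TR2DF-weight-bound {Δ} deg≤Δ tr = begin
    2 * n                                  ≡⟨ ∑-const n 2 ⟨
    ∑[ v < n ] 2                           ≤⟨ ∑-mono-≤ (2≤closedNeighbourhoodWeight tr) ⟩
    ∑[ v < n ] closedNeighbourhoodWeight v ≤⟨ ∑-closedNeighbourhoodWeight≤ deg≤Δ ⟩
    weight f * suc Δ                       ∎
    where open ≤-Reasoning

  TR2DF-weight-bound-strict : ∀ {Δ} → (∀ v → degree G v ≤ Δ) → IsTR2DF G f →
    ∀ v → f v ≡ 2 → 2 * n < weight f * suc Δ
  TR2DF-weight-bound-strict {Δ} deg≤Δ tr v fv≡2 = begin-strict
    2 * n                                  ≡⟨ ∑-const n 2 ⟨
    ∑[ v < n ] 2                           <⟨ ∑-mono-< (2≤closedNeighbourhoodWeight tr) v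
                                                        (3≤closedNeighbourhoodWeight tr v fv≡2) ⟩
    ∑[ v < n ] closedNeighbourhoodWeight v ≤⟨ ∑-closedNeighbourhoodWeight≤ deg≤Δ ⟩
    weight f * suc Δ                       ∎
    where open ≤-Reasoning

ceilDivSuc-≤ : ∀ {a b k} → a ≤ k * suc b → ceilDivSuc a b ≤ k
ceilDivSuc-≤ {a} {b} {k} a≤k[b+1] = ≤-pred (m<n*o⇒m/o<n (begin-strict
  a + b             ≤⟨ +-monoˡ-≤ b a≤k[b+1] ⟩
  k * suc b + b     <⟨ +-monoʳ-< (k * suc b) (n<1+n b) ⟩
  k * suc b + suc b ≡⟨ +-comm (k * suc b) (suc b) ⟩
  suc k * suc b     ∎))
  where open ≤-Reasoning

mainTheorem15 : ∀ {n} (G : Graph n) (Δ γ : ℕ) →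
    Nontrivial G → Connected G → IsMaxDegree G Δ → GammaTR2 G γ →
    ceilDivSuc (2 * n) Δ ≤ γ ×
    (γ * suc Δ ≡ 2 * n →
      ∀ f → IsGammaTR2Function G f → ∀ v → f v ≢ 2)
mainTheorem15 {n} G Δ γ _ _ (deg≤Δ , _) (f₀ , (f₀-tr , f₀-min) , wf₀≡γ) =
  ceilDivSuc-≤ (subst (λ w → 2 * n ≤ w * suc Δ) wf₀≡γ (TR2DF-weight-bound G f₀ deg≤Δ f₀-tr)) ,
  λ γ[Δ+1]≡2n f (f-tr , f-min) v fv≡2 → <-irrefl refl (begin-strict
    2 * n             <⟨ TR2DF-weight-bound-strict G f deg≤Δ f-tr v fv≡2 ⟩
    weight f * suc Δ  ≤⟨ *-monoˡ-≤ (suc Δ) (f-min f₀ f₀-tr) ⟩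
    weight f₀ * suc Δ ≡⟨ cong (_* suc Δ) wf₀≡γ ⟩
    γ * suc Δ         ≡⟨ γ[Δ+1]≡2n ⟩
    2 * n             ∎)
  where open ≤-Reasoning
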